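{- Let $G$ and $H$ be non-empty connected graphs, let $D\subseteq V(G)$ be a $c$-deletion set for $G$, and let $\phi$ be a locally surjective homomorphism from $G$ to $H$. Then $\phi(D)$ is a $c$-deletion set for $H$.
   Context: $G$ has no self-loops; $H$ may have self-loops (with $u\in N_H(u)$ if $uu\in E(H)$). A homomorphism $\phi:V(G)\to V(H)$ is locally surjective if $\phi(N_G(u))=N_H(\phi(u))$ for every $u\in V(G)$. A $c$-deletion set of a graph $X$ is a set $S\subseteq V(X)$ such that every connected component of $X\setminus S$ has at most $c$ vertices. -}

module Defs where

open import Data.Nat using (ℕ; suc; _<_)
open import Data.Fin using (Fin)
open import Data.Product using (Σ; ∃; _×_; _,_)
open import Data.Unit using (⊤)
open import Data.Empty using (⊥)
open import Relation.Nullary using (¬_)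
open import Relation.Binary.PropositionalEquality using (_≡_)
open import Function.Definitions using (Injective)
open import Function.Bundles using (_⇔_)

-- A finite (undirected) graph on vertex set Fin n; self-loops allowed
-- unless ruled out by 'Loopless'.
record Graph : Set₁ where
  field
    n   : ℕ
    Adj : Fin n → Fin n → Set
    sym : ∀ {u v} → Adj u v → Adj v u

open Graph public

V : Graph → Set
V X = Fin (n X)

Loopless : Graph → Set
Loopless X = ∀ (u : V X) → ¬ Adj X u u

NonEmpty : Graph → Set
NonEmpty X = 0 < n X

data Walk (X : Graph) (P : V X → Set) : V X → V X → Set where
  here : ∀ {u} → P u → Walk X P u u
  step : ∀ {u w v} → P u → Adj X u w → Walk X P w v → Walk X P u v

Connected : Graph → Set
Connected X = ∀ (u v : V X) → Walk X (λ _ → ⊤) u v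

Subset : Graph → Set₁
Subset X = V X → Set

-- Membership in the connected component of u in X \ S.
InComponent : (X : Graph) → Subset X → V X → V X → Set
InComponent X S u v = Walk X (λ x → ¬ S x) u v

AtMost : (X : Graph) → ℕ → (V X → Set) → Set
AtMost X c A = ∀ (f : Fin (suc c) → V X) → Injective _≡_ _≡_ f → (∀ i → A (f i)) → ⊥

DeletionSet : (X : Graph) → ℕ → Subset X → Set
DeletionSet X c S = ∀ (u : V X) → ¬ S u → AtMost X c (InComponent X S u)

-- Open neighbourhood (contains u iff u has a self-loop).
N : (X : Graph) → V X → Subset X
N X u v = Adj X u v

Image : (G H : Graph) → (V G → V H) → Subset G → Subset H
Image G H φ A w = ∃ λ v → A v × φ v ≡ w

LocallySurjective : (G H : Graph) → (V G → V H) → Set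
LocallySurjective G H φ = ∀ (u : V G) (w : V H) → Image G H φ (N G u) w ⇔ N H (φ u) w

{-# OPTIONS --safe #-}
-- A locally surjective homomorphism has the path-lifting property: a walk in H
-- starting at φ x lifts to a walk in G starting at x whose image is the given
-- walk.  Lifting the walks from w to the c + 1 members of a component of
-- H \ φ(D) from a preimage u of w gives c + 1 vertices of G, pairwise distinct
-- because their images are, all in the component of u in G \ D, since a vertex
-- mapped outside φ(D) is not in D.
module Submission where

open import Data.Nat using (ℕ; suc)
open import Data.Fin using (Fin; fromℕ<)
open import Data.Product using (∃; _×_; _,_; proj₁; proj₂)
open import Relation.Nullary using (¬_)
open import Relation.Binary.PropositionalEquality using (_≡_; refl; sym; trans; subst; cong)
open import Function.Bundles using (Equivalence)
open import Defs hiding (sym)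

mapWalk : ∀ {X : Graph} {P Q : Subset X} → (∀ {z} → P z → Q z) →
          ∀ {a b} → Walk X P a b → Walk X Q a b
mapWalk f (here p)   = here (f p)
mapWalk f (step p a w) = step (f p) a (mapWalk f w)

module _ {G H : Graph} {φ : V G → V H} (ls : LocallySurjective G H φ) where

  liftWalk : ∀ {P : Subset H} {a b} → Walk H P a b → (x : V G) → φ x ≡ a →
             ∃ λ y → φ y ≡ b × Walk G (λ z → P (φ z)) x y
  liftWalk {P} (here p) x φx≡a = x , φx≡a , here (subst P (sym φx≡a) p)
  liftWalk {P} (step {w = a′} p adj rest) x refl
    with Equivalence.from (ls x a′) adj
  ... | x′ , adjG , refl with liftWalk rest x′ refl
  ...   | y , φy≡b , walk = y , φy≡b , step p adjG walk

  surjective : NonEmpty G → Connected H → ∀ w → ∃ λ u → φ u ≡ w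
  surjective neG conH w =
    let (u , φu≡w , _) = liftWalk (conH (φ x₀) w) x₀ refl in u , φu≡w
    where x₀ = fromℕ< neG

lemma6 : (G H : Graph) → Loopless G → NonEmpty G → NonEmpty H →
    Connected G → Connected H → (c : ℕ) → (D : Subset G) → DeletionSet G c D →
    (φ : V G → V H) → LocallySurjective G H φ →
    DeletionSet H c (Image G H φ D)
lemma6 G H _ neG _ _ conH c D dsG φ ls w w∉φD f f-inj f∈comp =
  dsG u u∉D lift lift-injective lift∈component
  where
  preimage : ∃ λ u → φ u ≡ w
  preimage = surjective {G} {H} ls neG conH w

  u : V G
  u = proj₁ preimage

  φu≡w : φ u ≡ w
  φu≡w = proj₂ preimage

  u∉D : ¬ D u
  u∉D u∈D = w∉φD (u , u∈D , φu≡w)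

  lifted : ∀ i → ∃ λ y → φ y ≡ f i × Walk G (λ z → ¬ Image G H φ D (φ z)) u y
  lifted i = liftWalk {G} {H} ls (f∈comp i) u φu≡w

  lift : Fin (suc c) → V G
  lift i = proj₁ (lifted i)

  lift-injective : ∀ {i j} → lift i ≡ lift j → i ≡ j
  lift-injective {i} {j} e =
    f-inj (trans (sym (proj₁ (proj₂ (lifted i)))) (trans (cong φ e) (proj₁ (proj₂ (lifted j)))))

  lift∈component : ∀ i → InComponent G D u (lift i)
  lift∈component i = mapWalk (λ φz∉φD z∈D → φz∉φD (_ , z∈D , refl)) (proj₂ (proj₂ (lifted i)))
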